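{- Let $n\geq 3$. For every $\vec{x}\in\mathbb{Z}^n$, the function $f$ satisfies the $n$-dimensional tarai recurrence at $\vec{x}$: if $\vec{x}(1)\leq\vec{x}(2)$ then $f(\vec{x})=\vec{x}(2)$, and if $\vec{x}(1)>\vec{x}(2)$ then $f(\vec{x})=f(\vec{y})$, where $\vec{y}\in\mathbb{Z}^n$ is given by $\vec{y}(i)=f(\sigma(r^{i-1}(\vec{x})))$ for $i=1,\ldots,n$.
   Context: For $\vec{x}=\langle x_1,\ldots,x_n\rangle\in\mathbb{Z}^n$ write $\vec{x}(i)=x_i$, $\sigma(\vec{x})=\langle x_1-1,x_2,\ldots,x_n\rangle$ and $r(\vec{x})=\langle x_2,\ldots,x_n,x_1\rangle$. The function $g_b$ on integer sequences $\langle x_1,\ldots,x_j\rangle$ is defined recursively: if $j\leq 3$ then $g_b(x_1,\ldots,x_j)=x_j$; otherwise if $x_1=x_2+1$ or $x_2>x_3+1$ then $g_b(x_1,\ldots,x_j)=g_b(x_2,\ldots,x_j)$, else $g_b(x_1,\ldots,x_j)=\max\{x_3,x_j\}$. The Bailey–Cowles function $f$ on $\mathbb{Z}^n$ is: if there is $k<n$ with $x_1>x_2>\cdots>x_k\leq x_{k+1}$, then $f(x_1,\ldots,x_n)=g_b(x_1,\ldots,x_{k+1})$; otherwise $f(x_1,\ldots,x_n)=x_1$. -}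

module Defs where

open import Data.Nat using (ℕ; zero; suc)
open import Data.Integer using (ℤ; _-_; _≤_; _>_; _<?_; _≟_; _⊔_; 1ℤ)
open import Data.List using (List; []; _∷_)
open import Data.Maybe using (Maybe; just; nothing; map)
open import Data.Vec using (Vec; []; _∷_; _∷ʳ_; toList; lookup; tabulate)
open import Data.Fin using (Fin; toℕ)
open import Data.Bool using (if_then_else_; _∨_)
open import Relation.Nullary.Decidable using (⌊_⌋)
open import Function using (_∘_)

σ : ∀ {n} → Vec ℤ n → Vec ℤ n
σ [] = []
σ (x ∷ xs) = (x - 1ℤ) ∷ xs

r : ∀ {n} → Vec ℤ n → Vec ℤ n
r [] = []
r (x ∷ xs) = xs ∷ʳ x

iter : ∀ {A : Set} → ℕ → (A → A) → A → A
iter zero h a = a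
iter (suc k) h a = h (iter k h a)

-- the function g_b on integer sequences (g_b of the empty sequence is
-- never used; it is set to 0 arbitrarily)
last : ℤ → List ℤ → ℤ
last x [] = x
last x (y ∷ ys) = last y ys

gb : List ℤ → ℤ
gb [] = ℤ.pos 0
gb (x ∷ []) = x
gb (x ∷ y ∷ []) = y
gb (x ∷ y ∷ z ∷ []) = z
gb (x₁ ∷ x₂ ∷ x₃ ∷ x₄ ∷ xs) =
  if ⌊ x₁ ≟ (x₂ Data.Integer.+ 1ℤ) ⌋ ∨ ⌊ (x₃ Data.Integer.+ 1ℤ) <? x₂ ⌋
  then gb (x₂ ∷ x₃ ∷ x₄ ∷ xs)
  else x₃ ⊔ last x₄ xs

-- For x = ⟨x₁,…,xₙ⟩ (n ≥ 1): returns just ⟨x₁,…,x_{k+1}⟩ if there is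
-- k < n with x₁ > x₂ > ⋯ > x_k ≤ x_{k+1} (such k is unique), nothing otherwise.
descPrefix : ℤ → List ℤ → Maybe (List ℤ)
descPrefix x [] = nothing
descPrefix x (y ∷ ys) =
  if ⌊ y <? x ⌋ then map (x ∷_) (descPrefix y ys) else just (x ∷ y ∷ [])

fromMaybe : ℤ → Maybe (List ℤ) → ℤ
fromMaybe d nothing = d
fromMaybe d (just l) = gb l

f : ∀ {n} → Vec ℤ (suc n) → ℤ
f (x ∷ xs) = fromMaybe x (descPrefix x (toList xs))

-- i-th coordinate, 1-based in the paper: x(i) = lookup x (i-1)

-- Let x begin with its maximal chain C = x₁ > ⋯ > x_k ≤ x_{k+1}, so that f x = g_b C.
-- For i < k the coordinate y_{i+1} = f (σ (rⁱ x)) depends only on C.  Inducting along C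
-- from its tail, one shows that y again begins with a chain whose g_b value and last
-- entry both equal g_b C; the case analysis at each step is on the gaps x_i - x_{i+1}
-- (= 1, = 2 or > 2), which decide both g_b and f ∘ σ on a chain.  Hence f y = g_b C.
-- If x is strictly decreasing then f x = x₁ and y₁ = x₁ - 1, while the remaining
-- coordinates come from the chain x₂ > ⋯ > x_n ≤ x₁ of r x, whose g_b value is x₁;
-- the same invariant then gives f y = x₁.
module Submission where

open import Defs
open import Data.Nat using (ℕ; zero; suc; s≤s) renaming (_+_ to _+ℕ_; _≤_ to _≤ℕ_)
import Data.Nat.Properties as ℕ
open import Data.Integer using (ℤ; _≤_; _<_; _>_; _+_; _-_; -_; _⊔_; 1ℤ; _≟_; _<?_)
open import Data.Integer.Properties
open import Data.List using (List; []; _∷_; _++_; length; applyUpTo)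
import Data.List.Properties as List
open import Data.Maybe using (just; nothing)
open import Data.Vec using (Vec; toList; tabulate; lookup) renaming (_∷_ to _∷ᵥ_)
import Data.Vec.Properties as Vec
open import Data.Fin using (Fin; toℕ) renaming (zero to fzero; suc to fsuc)
open import Data.Sum using (_⊎_; inj₁; inj₂)
open import Data.Product using (_×_; _,_; Σ-syntax; proj₁; proj₂)
open import Relation.Nullary using (¬_; yes; no; toSum)
open import Relation.Nullary.Negation using (contradiction)
open import Relation.Binary.PropositionalEquality

i+1-1≡i : ∀ i → i + 1ℤ - 1ℤ ≡ i
i+1-1≡i i = trans (+-assoc i 1ℤ (- 1ℤ)) (+-identityʳ i)

i-1+1≡i : ∀ i → i - 1ℤ + 1ℤ ≡ i
i-1+1≡i i = trans (+-assoc i (- 1ℤ) 1ℤ) (+-identityʳ i)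

i<j⇒i+1≤j : ∀ {i j} → i < j → i + 1ℤ ≤ j
i<j⇒i+1≤j {i} p = subst (_≤ _) (+-comm 1ℤ i) (i<j⇒suc[i]≤j p)

i+1≤j⇒i<j : ∀ {i j} → i + 1ℤ ≤ j → i < j
i+1≤j⇒i<j {i} p = suc[i]≤j⇒i<j (subst (_≤ _) (+-comm i 1ℤ) p)

i<i+1 : ∀ i → i < i + 1ℤ
i<i+1 i = i+1≤j⇒i<j ≤-refl

i-1<i : ∀ i → i - 1ℤ < i
i-1<i i = subst (i - 1ℤ <_) (i-1+1≡i i) (i<i+1 (i - 1ℤ))

i<j⇒i≤j-1 : ∀ {i j} → i < j → i ≤ j - 1ℤ
i<j⇒i≤j-1 {i} {j} p = subst (_≤ j - 1ℤ) (i+1-1≡i i) (+-monoˡ-≤ (- 1ℤ) (i<j⇒i+1≤j p))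

i+1<j⇒i<j-1 : ∀ {i j} → i + 1ℤ < j → i < j - 1ℤ
i+1<j⇒i<j-1 p = i+1≤j⇒i<j (i<j⇒i≤j-1 p)

i<j⇒j≡i+1⊎j≡i+2⊎i+2<j : ∀ {i j} → i < j →
  j ≡ i + 1ℤ ⊎ j ≡ i + 1ℤ + 1ℤ ⊎ i + 1ℤ + 1ℤ < j
i<j⇒j≡i+1⊎j≡i+2⊎i+2<j {i} {j} i<j with i + 1ℤ ≟ j
... | yes i+1≡j = inj₁ (sym i+1≡j)
... | no i+1≢j with i + 1ℤ + 1ℤ ≟ j
...   | yes i+2≡j = inj₂ (inj₁ (sym i+2≡j))
...   | no i+2≢j = inj₂ (inj₂ (≤∧≢⇒< (i<j⇒i+1≤j (≤∧≢⇒< (i<j⇒i+1≤j i<j) i+1≢j)) i+2≢j))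

j≡i+2⇒j≢i+1 : ∀ i {j} → j ≡ i + 1ℤ + 1ℤ → j ≢ i + 1ℤ
j≡i+2⇒j≢i+1 i j≡i+2 j≡i+1 = <-irrefl (trans (sym j≡i+1) j≡i+2) (i<i+1 (i + 1ℤ))

i+2<j⇒j≢i+1 : ∀ i {j} → i + 1ℤ + 1ℤ < j → j ≢ i + 1ℤ
i+2<j⇒j≢i+1 i i+2<j j≡i+1 = <-asym (i<i+1 (i + 1ℤ)) (subst (_ <_) j≡i+1 i+2<j)

j≡i+2⇒i+1<j : ∀ i {j} → j ≡ i + 1ℤ + 1ℤ → i + 1ℤ < j
j≡i+2⇒i+1<j i j≡i+2 = subst (_ <_) (sym j≡i+2) (i<i+1 (i + 1ℤ))

i+2<j⇒i+1<j : ∀ i {j} → i + 1ℤ + 1ℤ < j → i + 1ℤ < j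
i+2<j⇒i+1<j i = <-trans (i<i+1 (i + 1ℤ))

c<c⊔t⇒squeeze : ∀ {c t x} → c < c ⊔ t → t ≤ x → x ≤ c ⊔ t → x ≡ c ⊔ t
c<c⊔t⇒squeeze {c} {t} c<c⊔t t≤x x≤c⊔t with ≤-total c t
... | inj₁ c≤t = ≤-antisym x≤c⊔t (subst (_≤ _) (sym (i≤j⇒i⊔j≡j c≤t)) t≤x)
... | inj₂ t≤c = contradiction (sym (i≥j⇒i⊔j≡i t≤c)) (<⇒≢ c<c⊔t)

data Chain : List ℤ → Set where
  end  : ∀ {a t} → a ≤ t → Chain (a ∷ t ∷ [])
  desc : ∀ {a b l} → b < a → Chain (b ∷ l) → Chain (a ∷ b ∷ l)

chain-tail : ∀ {a b c l} → Chain (a ∷ b ∷ c ∷ l) → Chain (b ∷ c ∷ l)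
chain-tail (desc _ ch) = ch

chain-head : ∀ {a b c l} → Chain (a ∷ b ∷ c ∷ l) → b < a
chain-head (desc b<a _) = b<a

descPrefix-chain : ∀ {a l} → Chain (a ∷ l) → ∀ m → descPrefix a (l ++ m) ≡ just (a ∷ l)
descPrefix-chain {a} (end {t = t} a≤t) m with t <? a
... | yes t<a = contradiction a≤t (<⇒≱ t<a)
... | no _ = refl
descPrefix-chain {a} (desc {b = b} b<a ch) m with b <? a
... | yes _ rewrite descPrefix-chain ch m = refl
... | no b≮a = contradiction b<a b≮a

descPrefix-chain-[] : ∀ {a l} → Chain (a ∷ l) → descPrefix a l ≡ just (a ∷ l)
descPrefix-chain-[] {a} {l} ch =
  trans (cong (descPrefix a) (sym (List.++-identityʳ l))) (descPrefix-chain ch [])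

descPrefix-++ : ∀ h b l m → h ≤ b ⊎ Chain (b ∷ l) →
  descPrefix h (b ∷ l ++ m) ≡ descPrefix h (b ∷ l)
descPrefix-++ h b l m c with b <? h
descPrefix-++ h b l m (inj₁ h≤b) | yes b<h = contradiction h≤b (<⇒≱ b<h)
descPrefix-++ h b l m (inj₂ ch)  | yes _ rewrite descPrefix-chain ch m | descPrefix-chain-[] ch = refl
... | no _ = refl

descPrefix-just⇒chain : ∀ a l C → descPrefix a l ≡ just C →
  Chain C × Σ[ M ∈ List ℤ ] a ∷ l ≡ C ++ M
descPrefix-just⇒chain a [] C ()
descPrefix-just⇒chain a (b ∷ l) C eq with b <? a
descPrefix-just⇒chain a (b ∷ l) C refl | no b≮a = end (≮⇒≥ b≮a) , l , refl
descPrefix-just⇒chain a (b ∷ l) C eq | yes b<a with descPrefix b l in e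
descPrefix-just⇒chain a (b ∷ l) C () | yes b<a | nothing
descPrefix-just⇒chain a (b ∷ l) C refl | yes b<a | just C′
  with C′ | descPrefix-just⇒chain b l C′ e
... | [] | () , _
... | _ ∷ _ | ch , M , b∷l≡C′++M with List.∷-injective b∷l≡C′++M
... | refl , _ = desc b<a ch , M , cong (a ∷_) b∷l≡C′++M

descPrefix-nothing : ∀ {a b l} → descPrefix a (b ∷ l) ≡ nothing →
  b < a × descPrefix b l ≡ nothing
descPrefix-nothing {a} {b} {l} eq with b <? a
descPrefix-nothing () | no _
... | yes b<a with descPrefix b l
... | nothing = b<a , refl

descending-chain : ∀ b l t → descPrefix b l ≡ nothing → b ≤ t → Chain (b ∷ l ++ t ∷ [])
descending-chain b [] t _ b≤t = end b≤t
descending-chain b (c ∷ l) t e b≤t with descPrefix-nothing {b} {c} {l} e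
... | c<b , e′ = desc c<b (descending-chain c l t e′ (≤-trans (<⇒≤ c<b) b≤t))

last-++ : ∀ a l t → last a (l ++ t ∷ []) ≡ t
last-++ a [] t = refl
last-++ a (c ∷ l) t = last-++ c l t

gb-skip : ∀ x y z l → x ≡ y + 1ℤ ⊎ z + 1ℤ < y → gb (x ∷ y ∷ z ∷ l) ≡ gb (y ∷ z ∷ l)
gb-skip x y z [] _ = refl
gb-skip x y z (w ∷ l) c with x ≟ y + 1ℤ | z + 1ℤ <? y
... | yes _ | _ = refl
... | no _ | yes _ = refl
gb-skip x y z (w ∷ l) (inj₁ e) | no x≢y+1 | no _ = contradiction e x≢y+1
gb-skip x y z (w ∷ l) (inj₂ p) | no _ | no z+1≮y = contradiction p z+1≮y

gb-stop : ∀ x y z w l → x ≢ y + 1ℤ → ¬ (z + 1ℤ < y) → gb (x ∷ y ∷ z ∷ w ∷ l) ≡ z ⊔ last w l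
gb-stop x y z w l x≢y+1 z+1≮y with x ≟ y + 1ℤ | z + 1ℤ <? y
... | yes e | _ = contradiction e x≢y+1
... | no _ | yes p = contradiction p z+1≮y
... | no _ | no _ = refl

gb-bounds : ∀ {x y l} → Chain (x ∷ y ∷ l) →
  last y l ≤ gb (x ∷ y ∷ l) × gb (x ∷ y ∷ l) ≤ y ⊔ last y l
gb-bounds {y = y} {[]} (end _) = ≤-refl , i≤j⊔i y y
gb-bounds {y = y} {z ∷ []} (desc _ _) = ≤-refl , i≤j⊔i y z
gb-bounds {x} {y} {z ∷ w ∷ l} (desc _ ch@(desc z<y _)) = bounds-step (gb-bounds ch)
  where
  y⊔t : ∀ {g} → g ≤ z ⊔ last w l → g ≤ y ⊔ last w l
  y⊔t g≤ = ≤-trans g≤ (⊔-lub (≤-trans (<⇒≤ z<y) (i≤i⊔j y _)) (i≤j⊔i y _))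
  bounds-step : last w l ≤ gb (y ∷ z ∷ w ∷ l) × gb (y ∷ z ∷ w ∷ l) ≤ z ⊔ last w l →
    last w l ≤ gb (x ∷ y ∷ z ∷ w ∷ l) × gb (x ∷ y ∷ z ∷ w ∷ l) ≤ y ⊔ last w l
  bounds-step (t≤g , g≤) with x ≟ y + 1ℤ | z + 1ℤ <? y
  ... | yes _ | _ = t≤g , y⊔t g≤
  ... | no _ | yes _ = t≤g , y⊔t g≤
  ... | no _ | no _ = i≤j⊔i z _ , y⊔t ≤-refl

gb-tail≤gb : ∀ {x y z l} → Chain (x ∷ y ∷ z ∷ l) → gb (y ∷ z ∷ l) ≤ gb (x ∷ y ∷ z ∷ l)
gb-tail≤gb {l = []} _ = ≤-refl
gb-tail≤gb {x} {y} {z} {w ∷ l} (desc _ ch) with x ≟ y + 1ℤ | z + 1ℤ <? y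
... | yes _ | _ = ≤-refl
... | no _ | yes _ = ≤-refl
... | no _ | no _ = proj₂ (gb-bounds ch)

gb-cases : ∀ {b c d} l → Chain (c ∷ d ∷ l) →
  gb (b ∷ c ∷ d ∷ l) ≡ gb (c ∷ d ∷ l) ⊎ (d < c × gb (b ∷ c ∷ d ∷ l) ≡ d ⊔ last d l)
gb-cases [] _ = inj₁ refl
gb-cases {b} {c} {d} (w ∷ l) ch with toSum (b ≟ c + 1ℤ) | toSum (d + 1ℤ <? c)
... | inj₁ e | _ = inj₁ (gb-skip b c d (w ∷ l) (inj₁ e))
... | inj₂ _ | inj₁ p = inj₁ (gb-skip b c d (w ∷ l) (inj₂ p))
... | inj₂ b≢c+1 | inj₂ d+1≮c = inj₂ (chain-head ch , gb-stop b c d w l b≢c+1 d+1≮c)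

gb-extend : ∀ y y′ q rest → Chain (y′ ∷ q ∷ rest) → gb (y′ ∷ q ∷ rest) ≡ last q rest →
  (y ≢ y′ + 1ℤ → q < y′ → q ≤ last q rest) → gb (y ∷ y′ ∷ q ∷ rest) ≡ last q rest
gb-extend y y′ q [] _ _ _ = refl
gb-extend y y′ q (s ∷ rest) ch eq side with toSum (y ≟ y′ + 1ℤ) | toSum (q + 1ℤ <? y′)
... | inj₁ e | _ = trans (gb-skip y y′ q (s ∷ rest) (inj₁ e)) eq
... | inj₂ _ | inj₁ p = trans (gb-skip y y′ q (s ∷ rest) (inj₂ p)) eq
... | inj₂ y≢y′+1 | inj₂ q+1≮y′ =
  trans (gb-stop y y′ q s rest y≢y′+1 q+1≮y′) (i≤j⇒i⊔j≡j (side y≢y′+1 (chain-head ch)))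

fList : ℤ → List ℤ → ℤ
fList x xs = fromMaybe x (descPrefix x xs)

fσ : ℤ → List ℤ → ℤ
fσ a l = fList (a - 1ℤ) l

σ-values : List ℤ → List ℤ
σ-values (a ∷ b ∷ l) = fσ a (b ∷ l) ∷ σ-values (b ∷ l)
σ-values _ = []

fList-stop : ∀ {a b} l → ¬ b < a → fList a (b ∷ l) ≡ b
fList-stop {a} {b} l b≮a with b <? a
... | yes b<a = contradiction b<a b≮a
... | no _ = refl

fσ-end : ∀ {c t} → c ≤ t → fσ c (t ∷ []) ≡ t
fσ-end {c} c≤t = fList-stop [] (λ t<c-1 → <⇒≱ (<-trans t<c-1 (i-1<i c)) c≤t)

fσ-desc : ∀ a b L → Chain (b ∷ L) → b < a - 1ℤ → fσ a (b ∷ L) ≡ gb (a - 1ℤ ∷ b ∷ L)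
fσ-desc a b L ch b<a-1 rewrite descPrefix-chain-[] (desc b<a-1 ch) = refl

gb-pred-head : ∀ a b L → Chain (b ∷ L) → b + 1ℤ + 1ℤ < a → gb (a - 1ℤ ∷ b ∷ L) ≡ gb (a ∷ b ∷ L)
gb-pred-head a b (c ∷ []) _ _ = refl
gb-pred-head a b (c ∷ w ∷ L) _ b+2<a with toSum (c + 1ℤ <? b)
... | inj₁ c+1<b = trans (gb-skip (a - 1ℤ) b c (w ∷ L) (inj₂ c+1<b)) (sym (gb-skip a b c (w ∷ L) (inj₂ c+1<b)))
... | inj₂ c+1≮b = trans (gb-stop (a - 1ℤ) b c w L a-1≢b+1 c+1≮b) (sym (gb-stop a b c w L a≢b+1 c+1≮b))
  where
  a-1≢b+1 : a - 1ℤ ≢ b + 1ℤ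
  a-1≢b+1 e = <-irrefl refl (subst (b + 1ℤ + 1ℤ <_) (trans (sym (i-1+1≡i a)) (cong (_+ 1ℤ) e)) b+2<a)
  a≢b+1 : a ≢ b + 1ℤ
  a≢b+1 e = <-asym (i<i+1 (b + 1ℤ)) (subst (b + 1ℤ + 1ℤ <_) e b+2<a)

fσ-cases : ∀ {a b c L′} → Chain (a ∷ b ∷ c ∷ L′) → let L = c ∷ L′ in
  (a ≡ b + 1ℤ × fσ a (b ∷ L) ≡ b) ⊎
  (a ≡ b + 1ℤ + 1ℤ × fσ a (b ∷ L) ≡ gb (b ∷ L)) ⊎
  (b + 1ℤ + 1ℤ < a × fσ a (b ∷ L) ≡ gb (a ∷ b ∷ L))
fσ-cases {a} {b} {c} {L′} (desc b<a ch) with i<j⇒j≡i+1⊎j≡i+2⊎i+2<j b<a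
... | inj₁ a≡b+1 = inj₁ (a≡b+1 , fList-stop (c ∷ L′) b≮a-1)
  where
  b≮a-1 : ¬ b < a - 1ℤ
  b≮a-1 = <-irrefl (sym (trans (cong (_- 1ℤ) a≡b+1) (i+1-1≡i b)))
... | inj₂ (inj₁ a≡b+2) = inj₂ (inj₁ (a≡b+2 , trans (fσ-desc a b (c ∷ L′) ch b<a-1) skip))
  where
  a-1≡b+1 : a - 1ℤ ≡ b + 1ℤ
  a-1≡b+1 = trans (cong (_- 1ℤ) a≡b+2) (i+1-1≡i (b + 1ℤ))
  b<a-1 : b < a - 1ℤ
  b<a-1 = subst (b <_) (sym a-1≡b+1) (i<i+1 b)
  skip : gb (a - 1ℤ ∷ b ∷ c ∷ L′) ≡ gb (b ∷ c ∷ L′)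
  skip = gb-skip (a - 1ℤ) b c L′ (inj₁ a-1≡b+1)
... | inj₂ (inj₂ b+2<a) = inj₂ (inj₂ (b+2<a ,
  trans (fσ-desc a b (c ∷ L′) ch (i+1<j⇒i<j-1 (<-trans (i<i+1 (b + 1ℤ)) b+2<a)))
        (gb-pred-head a b (c ∷ L′) ch b+2<a)))

module DescentStep {a b c d : ℤ} {l : List ℤ} (ch : Chain (a ∷ b ∷ c ∷ d ∷ l)) where
  ch₁ : Chain (b ∷ c ∷ d ∷ l)
  ch₁ = chain-tail ch
  ch₂ : Chain (c ∷ d ∷ l)
  ch₂ = chain-tail ch₁
  c<b : c < b
  c<b = chain-head ch₁

  y₀ y₁ y₂ g₀ g₁ g₂ t : ℤ
  y₀ = fσ a (b ∷ c ∷ d ∷ l)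
  y₁ = fσ b (c ∷ d ∷ l)
  y₂ = fσ c (d ∷ l)
  g₀ = gb (a ∷ b ∷ c ∷ d ∷ l)
  g₁ = gb (b ∷ c ∷ d ∷ l)
  g₂ = gb (c ∷ d ∷ l)
  t = last d l

  a≡b+1⇒g₀≡g₁ : a ≡ b + 1ℤ → g₀ ≡ g₁
  a≡b+1⇒g₀≡g₁ e = gb-skip a b c (d ∷ l) (inj₁ e)
  c+1<b⇒g₀≡g₁ : c + 1ℤ < b → g₀ ≡ g₁
  c+1<b⇒g₀≡g₁ p = gb-skip a b c (d ∷ l) (inj₂ p)
  b≡c+1⇒g₀≡c⊔t : a ≢ b + 1ℤ → b ≡ c + 1ℤ → g₀ ≡ c ⊔ t
  b≡c+1⇒g₀≡c⊔t a≢b+1 b≡c+1 = gb-stop a b c d l a≢b+1 (<-irrefl (sym b≡c+1))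

  t≤g₁ : t ≤ g₁
  t≤g₁ = proj₁ (gb-bounds ch₁)
  g₁≤c⊔t : g₁ ≤ c ⊔ t
  g₁≤c⊔t = proj₂ (gb-bounds ch₁)
  g₂≤g₁ : g₂ ≤ g₁
  g₂≤g₁ = gb-tail≤gb ch₁

  y₀≤y₁⇒y₁≡g₀ : y₀ ≤ y₁ → y₁ ≡ g₀
  y₀≤y₁⇒y₁≡g₀ y₀≤y₁ with fσ-cases ch | fσ-cases ch₁
  ... | inj₁ (_ , y₀≡b) | inj₁ (_ , y₁≡c) = contradiction (subst₂ _≤_ y₀≡b y₁≡c y₀≤y₁) (<⇒≱ c<b)
  ... | inj₁ (a≡b+1 , y₀≡b) | inj₂ (inj₁ (_ , y₁≡g₂)) = trans y₁≡g₂ (trans g₂≡g₁ (sym (a≡b+1⇒g₀≡g₁ a≡b+1)))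
    where
    b≤g₂ : b ≤ g₂
    b≤g₂ = subst₂ _≤_ y₀≡b y₁≡g₂ y₀≤y₁
    g₂≡g₁ : g₂ ≡ g₁
    g₂≡g₁ with gb-cases {b} l ch₂
    ... | inj₁ g₁≡g₂ = sym g₁≡g₂
    ... | inj₂ (d<c , g₁≡d⊔t) = ≤-antisym g₂≤g₁
      (subst (_≤ g₂) (sym g₁≡d⊔t) (⊔-lub (<⇒≤ (<-trans d<c (<-≤-trans c<b b≤g₂))) (proj₁ (gb-bounds ch₂))))
  ... | inj₁ (a≡b+1 , _) | inj₂ (inj₂ (_ , y₁≡g₁)) = trans y₁≡g₁ (sym (a≡b+1⇒g₀≡g₁ a≡b+1))
  ... | inj₂ (inj₁ (a≡b+2 , y₀≡g₁)) | inj₁ (b≡c+1 , y₁≡c) =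
    trans y₁≡c (trans (sym (i≥j⇒i⊔j≡i t≤c)) (sym (b≡c+1⇒g₀≡c⊔t (j≡i+2⇒j≢i+1 b a≡b+2) b≡c+1)))
    where
    t≤c : t ≤ c
    t≤c = ≤-trans t≤g₁ (subst₂ _≤_ y₀≡g₁ y₁≡c y₀≤y₁)
  ... | inj₂ (inj₁ (_ , y₀≡g₁)) | inj₂ (inj₁ (b≡c+2 , y₁≡g₂)) =
    trans y₁≡g₂ (trans (≤-antisym g₂≤g₁ (subst₂ _≤_ y₀≡g₁ y₁≡g₂ y₀≤y₁)) (sym (c+1<b⇒g₀≡g₁ (j≡i+2⇒i+1<j c b≡c+2))))
  ... | inj₂ (inj₁ _) | inj₂ (inj₂ (c+2<b , y₁≡g₁)) = trans y₁≡g₁ (sym (c+1<b⇒g₀≡g₁ (i+2<j⇒i+1<j c c+2<b)))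
  ... | inj₂ (inj₂ (b+2<a , y₀≡g₀)) | inj₁ (b≡c+1 , y₁≡c) =
    trans y₁≡c (≤-antisym (subst (c ≤_) (sym (b≡c+1⇒g₀≡c⊔t (i+2<j⇒j≢i+1 b b+2<a) b≡c+1)) (i≤i⊔j c t))
                          (subst₂ _≤_ y₀≡g₀ y₁≡c y₀≤y₁))
  ... | inj₂ (inj₂ (_ , y₀≡g₀)) | inj₂ (inj₁ (b≡c+2 , y₁≡g₂)) =
    trans y₁≡g₂ (≤-antisym (subst (g₂ ≤_) (sym (c+1<b⇒g₀≡g₁ (j≡i+2⇒i+1<j c b≡c+2))) g₂≤g₁)
                           (subst₂ _≤_ y₀≡g₀ y₁≡g₂ y₀≤y₁))
  ... | inj₂ (inj₂ _) | inj₂ (inj₂ (c+2<b , y₁≡g₁)) = trans y₁≡g₁ (sym (c+1<b⇒g₀≡g₁ (i+2<j⇒i+1<j c c+2<b)))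

  y₁<y₀⇒g₁≡g₀ : y₁ < y₀ → g₁ ≡ g₀
  y₁<y₀⇒g₁≡g₀ y₁<y₀ with fσ-cases ch | fσ-cases ch₁
  ... | inj₁ (a≡b+1 , _) | _ = sym (a≡b+1⇒g₀≡g₁ a≡b+1)
  ... | _ | inj₂ (inj₁ (b≡c+2 , _)) = sym (c+1<b⇒g₀≡g₁ (j≡i+2⇒i+1<j c b≡c+2))
  ... | _ | inj₂ (inj₂ (c+2<b , _)) = sym (c+1<b⇒g₀≡g₁ (i+2<j⇒i+1<j c c+2<b))
  ... | inj₂ (inj₁ (a≡b+2 , y₀≡g₁)) | inj₁ (b≡c+1 , y₁≡c) =
    trans (c<c⊔t⇒squeeze (<-≤-trans (subst₂ _<_ y₁≡c y₀≡g₁ y₁<y₀) g₁≤c⊔t) t≤g₁ g₁≤c⊔t)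
          (sym (b≡c+1⇒g₀≡c⊔t (j≡i+2⇒j≢i+1 b a≡b+2) b≡c+1))
  ... | inj₂ (inj₂ (b+2<a , y₀≡g₀)) | inj₁ (b≡c+1 , y₁≡c) =
    trans (c<c⊔t⇒squeeze c<c⊔t t≤g₁ g₁≤c⊔t) (sym g₀≡c⊔t)
    where
    g₀≡c⊔t : g₀ ≡ c ⊔ t
    g₀≡c⊔t = b≡c+1⇒g₀≡c⊔t (i+2<j⇒j≢i+1 b b+2<a) b≡c+1
    c<c⊔t : c < c ⊔ t
    c<c⊔t = subst (c <_) g₀≡c⊔t (subst₂ _<_ y₁≡c y₀≡g₀ y₁<y₀)

  y₂≤g₁ : y₁ < y₀ → y₀ ≢ y₁ + 1ℤ → y₂ < y₁ → y₂ ≤ g₁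
  y₂≤g₁ y₁<y₀ y₀≢y₁+1 y₂<y₁ with fσ-cases ch₁
  ... | inj₂ (inj₁ (_ , y₁≡g₂)) = <⇒≤ (<-≤-trans y₂<y₁ (subst (_≤ g₁) (sym y₁≡g₂) g₂≤g₁))
  ... | inj₂ (inj₂ (_ , y₁≡g₁)) = <⇒≤ (<-≤-trans y₂<y₁ (≤-reflexive y₁≡g₁))
  ... | inj₁ (b≡c+1 , y₁≡c) = fσ≤gb l ch₂ c<g₁
    where
    y₀≤g₁ : y₀ ≤ g₁
    y₀≤g₁ with fσ-cases ch
    ... | inj₁ (a≡b+1 , y₀≡b) = contradiction (trans y₀≡b (trans b≡c+1 (cong (_+ 1ℤ) (sym y₁≡c)))) y₀≢y₁+1
    ... | inj₂ (inj₁ (_ , y₀≡g₁)) = ≤-reflexive y₀≡g₁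
    ... | inj₂ (inj₂ (_ , y₀≡g₀)) = ≤-reflexive (trans y₀≡g₀ (sym (y₁<y₀⇒g₁≡g₀ y₁<y₀)))
    c<g₁ : c < g₁
    c<g₁ = <-≤-trans (subst (_< y₀) y₁≡c y₁<y₀) y₀≤g₁
    fσ≤gb : ∀ l → Chain (c ∷ d ∷ l) → c < gb (b ∷ c ∷ d ∷ l) → fσ c (d ∷ l) ≤ gb (b ∷ c ∷ d ∷ l)
    fσ≤gb [] (end c≤d) _ = ≤-reflexive (fσ-end c≤d)
    fσ≤gb (w ∷ l′) ch′ c<g with fσ-cases ch′
    ... | inj₁ (_ , y≡d) = <⇒≤ (subst (_< gb (b ∷ c ∷ d ∷ w ∷ l′)) (sym y≡d) (<-trans (chain-head ch′) c<g))
    ... | inj₂ (inj₁ (_ , y≡g)) =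
      subst (_≤ gb (b ∷ c ∷ d ∷ w ∷ l′)) (sym y≡g) (≤-trans (gb-tail≤gb ch′) (gb-tail≤gb (desc c<b ch′)))
    ... | inj₂ (inj₂ (_ , y≡g)) = subst (_≤ gb (b ∷ c ∷ d ∷ w ∷ l′)) (sym y≡g) (gb-tail≤gb (desc c<b ch′))

record GbPrefix (y : ℤ) (ys : List ℤ) (v : ℤ) : Set where
  constructor gbPrefix
  field
    chainTail rest : List ℤ
    split : ys ≡ chainTail ++ rest
    chain : Chain (y ∷ chainTail)
    gb≡ : gb (y ∷ chainTail) ≡ v
    last≡ : last y chainTail ≡ v

σ-values-gbPrefix : ∀ {a b c} l → Chain (a ∷ b ∷ c ∷ l) →
  GbPrefix (fσ a (b ∷ c ∷ l)) (σ-values (b ∷ c ∷ l)) (gb (a ∷ b ∷ c ∷ l))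
σ-values-gbPrefix {a} {b} {c} [] ch@(desc _ (end b≤c)) =
  gbPrefix (fσ b (c ∷ []) ∷ []) [] refl (end y₀≤y₁) (fσ-end b≤c) (fσ-end b≤c)
  where
  y₀≤c : fσ a (b ∷ c ∷ []) ≤ c
  y₀≤c with fσ-cases ch
  ... | inj₁ (_ , y₀≡b) = subst (_≤ c) (sym y₀≡b) b≤c
  ... | inj₂ (inj₁ (_ , y₀≡c)) = ≤-reflexive y₀≡c
  ... | inj₂ (inj₂ (_ , y₀≡c)) = ≤-reflexive y₀≡c
  y₀≤y₁ : fσ a (b ∷ c ∷ []) ≤ fσ b (c ∷ [])
  y₀≤y₁ = subst (fσ a (b ∷ c ∷ []) ≤_) (sym (fσ-end b≤c)) y₀≤c
σ-values-gbPrefix {a} {b} {c} (d ∷ l) ch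
  with σ-values-gbPrefix l (chain-tail ch) | toSum (fσ b (c ∷ d ∷ l) <? fσ a (b ∷ c ∷ d ∷ l))
... | _ | inj₂ y₁≮y₀ =
  gbPrefix (y₁ ∷ []) (σ-values (c ∷ d ∷ l)) refl (end (≮⇒≥ y₁≮y₀)) y₁≡g₀ y₁≡g₀
  where
  open DescentStep ch
  y₁≡g₀ : y₁ ≡ g₀
  y₁≡g₀ = y₀≤y₁⇒y₁≡g₀ (≮⇒≥ y₁≮y₀)
... | gbPrefix (q ∷ rest) W split chQ gbQ lastQ | inj₁ y₁<y₀ =
  gbPrefix (y₁ ∷ q ∷ rest) W (cong (y₁ ∷_) split) (desc y₁<y₀ chQ)
    (trans (gb-extend y₀ y₁ q rest chQ (trans gbQ (sym lastQ)) side) last≡g₀) last≡g₀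
  where
  open DescentStep ch
  last≡g₀ : last q rest ≡ g₀
  last≡g₀ = trans lastQ (y₁<y₀⇒g₁≡g₀ y₁<y₀)
  q≡y₂ : q ≡ y₂
  q≡y₂ = sym (List.∷-injectiveˡ split)
  side : y₀ ≢ y₁ + 1ℤ → q < y₁ → q ≤ last q rest
  side y₀≢y₁+1 q<y₁ = subst₂ _≤_ (sym q≡y₂) (sym lastQ) (y₂≤g₁ y₁<y₀ y₀≢y₁+1 (subst (_< y₁) q≡y₂ q<y₁))

fList-gbPrefix : ∀ {y ys v} → GbPrefix y ys v → ∀ R → fList y (ys ++ R) ≡ v
fList-gbPrefix {y} {ys} {v} (gbPrefix Q W split chQ gbQ _) R = begin
  fList y (ys ++ R)        ≡⟨ cong (λ zs → fList y (zs ++ R)) split ⟩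
  fList y ((Q ++ W) ++ R)  ≡⟨ cong (fList y) (List.++-assoc Q W R) ⟩
  fList y (Q ++ W ++ R)    ≡⟨ cong (fromMaybe y) (descPrefix-chain chQ (W ++ R)) ⟩
  gb (y ∷ Q)               ≡⟨ gbQ ⟩
  v                        ∎
  where open ≡-Reasoning

gb-chain-below-last : ∀ {a b c l} → Chain (a ∷ b ∷ c ∷ l) → a < last c l → gb (a ∷ b ∷ c ∷ l) ≡ last c l
gb-chain-below-last {b = b} {c} {l} ch a<t = ≤-antisym
  (≤-trans (proj₂ (gb-bounds ch)) (≤-reflexive (i≤j⇒i⊔j≡j (<⇒≤ (<-trans (chain-head ch) a<t)))))
  (proj₁ (gb-bounds ch))

fσ-below-last : ∀ {a b c l} → Chain (a ∷ b ∷ c ∷ l) → a < last c l →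
  ¬ fσ a (b ∷ c ∷ l) < last c l - 1ℤ → fσ a (b ∷ c ∷ l) ≡ last c l
fσ-below-last {a} {b} {c} {l} ch a<t y≮t-1 with fσ-cases ch
... | inj₁ (_ , y≡b) =
  contradiction (subst (_< _) (sym y≡b) (<-≤-trans (chain-head ch) (i<j⇒i≤j-1 a<t))) y≮t-1
... | inj₂ (inj₁ (_ , y≡g₁)) = trans y≡g₁ (≤-antisym
  (≤-trans (gb-tail≤gb ch) (≤-reflexive (gb-chain-below-last ch a<t)))
  (proj₁ (gb-bounds (chain-tail ch))))
... | inj₂ (inj₂ (_ , y≡g)) = trans y≡g (gb-chain-below-last ch a<t)

fList-pred-last : ∀ {a b L} → Chain (a ∷ b ∷ L) → a < last b L → ∀ R →
  fList (last b L - 1ℤ) (σ-values (a ∷ b ∷ L) ++ R) ≡ last b L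
fList-pred-last {a} {b} {[]} (end a≤b) _ R = trans (fList-stop R y≮b-1) (fσ-end a≤b)
  where
  y≮b-1 : ¬ fσ a (b ∷ []) < b - 1ℤ
  y≮b-1 y<b-1 = <-asym (i-1<i b) (subst (_< b - 1ℤ) (fσ-end a≤b) y<b-1)
fList-pred-last {a} {b} {c ∷ l} ch a<t R
  with σ-values-gbPrefix l ch | toSum (fσ a (b ∷ c ∷ l) <? last c l - 1ℤ)
... | _ | inj₂ y≮t-1 = trans (fList-stop (σ-values (b ∷ c ∷ l) ++ R) y≮t-1) (fσ-below-last ch a<t y≮t-1)
... | gbPrefix (q ∷ rest) W split chQ gbQ lastQ | inj₁ y<t-1 = begin
  fList (t - 1ℤ) (y ∷ σ-values (b ∷ c ∷ l) ++ R)   ≡⟨ cong (λ zs → fList (t - 1ℤ) (y ∷ zs)) ys++R≡ ⟩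
  fList (t - 1ℤ) (y ∷ (q ∷ rest) ++ W ++ R)        ≡⟨ cong (fromMaybe _) (descPrefix-chain (desc y<t-1 chQ) (W ++ R)) ⟩
  gb (t - 1ℤ ∷ y ∷ q ∷ rest)                        ≡⟨ gb-extend _ y q rest chQ (trans gbQ (sym lastQ)) side ⟩
  last q rest                                       ≡⟨ trans lastQ (gb-chain-below-last ch a<t) ⟩
  t                                                 ∎
  where
  open ≡-Reasoning
  t y : ℤ
  t = last c l
  y = fσ a (b ∷ c ∷ l)
  ys++R≡ : σ-values (b ∷ c ∷ l) ++ R ≡ (q ∷ rest) ++ W ++ R
  ys++R≡ = trans (cong (_++ R) split) (List.++-assoc (q ∷ rest) W R)
  side : t - 1ℤ ≢ y + 1ℤ → q < y → q ≤ last q rest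
  side _ q<y = subst (q ≤_) (sym (trans lastQ (gb-chain-below-last ch a<t)))
    (<⇒≤ (<-trans (<-trans q<y y<t-1) (i-1<i t)))

fσ-descending : ∀ {a b L} → b < a → descPrefix b L ≡ nothing → fσ a (b ∷ L) ≡ a - 1ℤ
fσ-descending {a} {b} b<a e with b <? a - 1ℤ
... | yes _ rewrite e = refl
... | no b≮a-1 = ≤-antisym (i<j⇒i≤j-1 b<a) (≮⇒≥ b≮a-1)

iter-suc : ∀ {A : Set} k (h : A → A) a → iter (suc k) h a ≡ iter k h (h a)
iter-suc zero h a = refl
iter-suc (suc k) h a = cong h (iter-suc k h a)

f-toList : ∀ {m a l} (v : Vec ℤ (suc m)) → toList v ≡ a ∷ l → f v ≡ fList a l
f-toList (x ∷ᵥ xs) eq with List.∷-injective eq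
... | refl , refl = refl

f-σ : ∀ {m a l} (v : Vec ℤ (suc m)) → toList v ≡ a ∷ l → f (σ v) ≡ fσ a l
f-σ (x ∷ᵥ xs) eq with List.∷-injective eq
... | refl , refl = refl

toList-r : ∀ {m a l} (v : Vec ℤ (suc m)) → toList v ≡ a ∷ l → toList (r v) ≡ l ++ a ∷ []
toList-r (x ∷ᵥ xs) eq with List.∷-injective eq
... | refl , refl = Vec.toList-∷ʳ x xs

prefix-length : ∀ {m} (v : Vec ℤ m) C {M} → toList v ≡ C ++ M → length C ≤ℕ m
prefix-length v C {M} eq = subst (length C ≤ℕ_)
  (trans (sym (List.length-++ C)) (trans (cong length (sym eq)) (Vec.length-toList v)))
  (ℕ.m≤m+n (length C) (length M))

-- For i + 1 < |C|, computing f (σ (rⁱ v)) never looks past the end of C, because the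
-- entries of C after position i again form a chain.
σ-values-prefix : ∀ {C} → Chain C → ∀ {m M} (v : Vec ℤ (suc m)) (g : ℕ → ℤ) →
  (∀ i → g i ≡ f (σ (iter i r v))) → toList v ≡ C ++ M → ∀ N → length C ≤ℕ suc N →
  Σ[ R ∈ List ℤ ] applyUpTo g N ≡ σ-values C ++ R
σ-values-prefix (end _) _ _ _ _ zero (s≤s ())
σ-values-prefix (desc _ _) _ _ _ _ zero (s≤s ())
σ-values-prefix (end {a} {t} a≤t) {M = M} v g g≡ eq (suc N) _ =
  applyUpTo (λ i → g (suc i)) N , cong (_∷ _) g₀≡
  where
  g₀≡ : g 0 ≡ fσ a (t ∷ [])
  g₀≡ = trans (g≡ 0) (trans (f-σ v eq)
    (cong (fromMaybe _) (descPrefix-++ (a - 1ℤ) t [] M (inj₁ (≤-trans (<⇒≤ (i-1<i a)) a≤t)))))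
σ-values-prefix (desc {a} {b} {l} _ ch) {M = M} v g g≡ eq (suc N) (s≤s len≤)
  with σ-values-prefix ch (r v) (λ i → g (suc i)) g≡′ eq′ N len≤
  where
  g≡′ : ∀ i → g (suc i) ≡ f (σ (iter i r (r v)))
  g≡′ i = trans (g≡ (suc i)) (cong (λ w → f (σ w)) (iter-suc i r v))
  eq′ : toList (r v) ≡ (b ∷ l) ++ M ++ a ∷ []
  eq′ = trans (toList-r v eq) (List.++-assoc (b ∷ l) M (a ∷ []))
... | R , eqR = R , cong₂ _∷_ g₀≡ eqR
  where
  g₀≡ : g 0 ≡ fσ a (b ∷ l)
  g₀≡ = trans (g≡ 0) (trans (f-σ v eq) (cong (fromMaybe _) (descPrefix-++ (a - 1ℤ) b l M (inj₂ ch))))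

fσr : ∀ {m} → Vec ℤ (suc m) → Vec ℤ (suc m)
fσr x = tabulate (λ i → f (σ (iter (toℕ i) r x)))

toList-tabulate-toℕ : ∀ n (G : ℕ → ℤ) → toList (tabulate {n = n} (λ i → G (toℕ i))) ≡ applyUpTo G n
toList-tabulate-toℕ zero G = refl
toList-tabulate-toℕ (suc n) G = cong (G 0 ∷_) (toList-tabulate-toℕ n (λ i → G (suc i)))

f-fσr : ∀ {m} (x : Vec ℤ (suc m)) →
  f (fσr x) ≡ fList (f (σ x)) (applyUpTo (λ i → f (σ (iter (suc i) r x))) m)
f-fσr {m} x = cong (fList _) (toList-tabulate-toℕ m (λ i → f (σ (iter (suc i) r x))))

f-fσr-chain : ∀ {m a b c l M} (x : Vec ℤ (suc m)) → Chain (a ∷ b ∷ c ∷ l) →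
  toList x ≡ (a ∷ b ∷ c ∷ l) ++ M → f (fσr x) ≡ gb (a ∷ b ∷ c ∷ l)
f-fσr-chain {m} {a} {b} {c} {l} x ch eq = begin
  f (fσr x)                                                ≡⟨ f-fσr x ⟩
  fList (f (σ x)) (applyUpTo (λ i → f (σ (iter (suc i) r x))) m)
    ≡⟨ cong₂ fList (List.∷-injectiveˡ (proj₂ prefix)) (List.∷-injectiveʳ (proj₂ prefix)) ⟩
  fList (fσ a (b ∷ c ∷ l)) (σ-values (b ∷ c ∷ l) ++ proj₁ prefix)
    ≡⟨ fList-gbPrefix (σ-values-gbPrefix l ch) (proj₁ prefix) ⟩
  gb (a ∷ b ∷ c ∷ l)                                       ∎
  where
  open ≡-Reasoning
  prefix : Σ[ R ∈ List ℤ ] applyUpTo (λ i → f (σ (iter i r x))) (suc m) ≡ σ-values (a ∷ b ∷ c ∷ l) ++ R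
  prefix = σ-values-prefix ch x _ (λ _ → refl) eq (suc m) (ℕ.m≤n⇒m≤1+n (prefix-length x (a ∷ b ∷ c ∷ l) eq))

f-fσr-descending : ∀ {m a b c l} (x : Vec ℤ (suc m)) → toList x ≡ a ∷ b ∷ c ∷ l →
  descPrefix a (b ∷ c ∷ l) ≡ nothing → f (fσr x) ≡ a
f-fσr-descending {m} {a} {b} {c} {l} x eq e = begin
  f (fσr x)                                                ≡⟨ f-fσr x ⟩
  fList (f (σ x)) (applyUpTo (λ i → f (σ (iter (suc i) r x))) m)
    ≡⟨ cong₂ fList (trans (f-σ x eq) (fσ-descending {L = c ∷ l} b<a e′)) (proj₂ prefix) ⟩
  fList (a - 1ℤ) (σ-values C ++ proj₁ prefix)
    ≡⟨ subst (λ t → fList (t - 1ℤ) (σ-values C ++ proj₁ prefix) ≡ t) (last-++ b (c ∷ l) a)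
             (fList-pred-last ch (subst (b <_) (sym (last-++ b (c ∷ l) a)) b<a) (proj₁ prefix)) ⟩
  a                                                        ∎
  where
  open ≡-Reasoning
  b<a : b < a
  b<a = proj₁ (descPrefix-nothing {a} {b} {c ∷ l} e)
  e′ : descPrefix b (c ∷ l) ≡ nothing
  e′ = proj₂ (descPrefix-nothing {a} {b} {c ∷ l} e)
  C : List ℤ
  C = b ∷ c ∷ l ++ a ∷ []
  ch : Chain C
  ch = descending-chain b (c ∷ l) a e′ (<⇒≤ b<a)
  rx≡ : toList (r x) ≡ C ++ []
  rx≡ = trans (toList-r x eq) (sym (List.++-identityʳ C))
  prefix : Σ[ R ∈ List ℤ ] applyUpTo (λ i → f (σ (iter (suc i) r x))) m ≡ σ-values C ++ R
  prefix = σ-values-prefix ch (r x) _ (λ i → cong (λ w → f (σ w)) (iter-suc i r x)) rx≡ m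
             (prefix-length (r x) C rx≡)

f-recurrence : ∀ {m a b c l} (x : Vec ℤ (suc m)) → toList x ≡ a ∷ b ∷ c ∷ l → b < a →
  f x ≡ f (fσr x)
f-recurrence {a = a} {b} {c} {l} x eq b<a = trans (f-toList x eq) (by-prefix _ refl)
  where
  by-prefix : ∀ p → descPrefix a (b ∷ c ∷ l) ≡ p → fromMaybe a p ≡ f (fσr x)
  by-prefix nothing e = sym (f-fσr-descending x eq e)
  by-prefix (just C) e with descPrefix-just⇒chain a (b ∷ c ∷ l) C e
  ... | end a≤b , _ , refl = contradiction a≤b (<⇒≱ b<a)
  ... | ch@(desc _ (end _)) , _ , a∷T≡C++M = sym (f-fσr-chain x ch (trans eq a∷T≡C++M))
  ... | ch@(desc _ (desc _ _)) , _ , a∷T≡C++M = sym (f-fσr-chain x ch (trans eq a∷T≡C++M))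

lemma3p11 : (k : ℕ) → (x : Vec ℤ (3 +ℕ k)) →
    ((lookup x fzero ≤ lookup x (fsuc fzero)) → f x ≡ lookup x (fsuc fzero))
    × ((lookup x fzero > lookup x (fsuc fzero)) →
        f x ≡ f (tabulate (λ (i : Fin (3 +ℕ k)) → f (σ (iter (toℕ i) r x)))))
lemma3p11 k x@(x₁ ∷ᵥ x₂ ∷ᵥ x₃ ∷ᵥ xs) =
  (λ x₁≤x₂ → fList-stop (x₃ ∷ toList xs) (≤⇒≯ x₁≤x₂)) , f-recurrence x refl
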